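{- Let $(\hat\tau,\vec\tau,\overleftarrow{\tau})$ be a conservative translation from a logic $\mathcal{L}''$ to a logic $\mathcal{L}'$ and let $\varphi''\in F_{\mathcal{L}''}$. Then $\models_{\mathcal{L}''}\varphi''$ implies $\models_{\mathcal{L}''\sqcup\mathcal{L}'}\varphi''$.
   Context: Each logic $\mathcal{L}$ has a signature $(C_{\mathcal{L},n})_{n\in\mathbb{N}}$, a denumerable set $P_{\mathcal{L}}$ of propositional symbols, a set $F_{\mathcal{L}}$ of formulas, a class $\mathcal{M}_{\mathcal{L}}$ of models and a satisfaction relation $\Vdash_{\mathcal{L}}\subseteq\mathcal{M}_{\mathcal{L}}\times F_{\mathcal{L}}$; $\models_{\mathcal{L}}\varphi$ means $M\Vdash_{\mathcal{L}}\varphi$ for all $M\in\mathcal{M}_{\mathcal{L}}$. $\mathcal{A}_{\mathcal{L}}$ is the collection of maps generated from $c^\bullet(\varphi_1,\dots,\varphi_n)=c(\varphi_1,\dots,\varphi_n)$ (0-ary constructors and propositional symbols as 0-argument maps) by composition, aggregation and projections. A constructor translation is an injective $\hat\tau:C_{\mathcal{L}''}\cup P_{\mathcal{L}''}\to\mathcal{A}_{\mathcal{L}'}$ sending $n$-ary constructors to $n$-argument maps, propositional symbols to 0-argument maps, 0-ary constructors to $c'^\bullet$ with $c'\in C_{\mathcal{L}',0}$, and such that for all $p'',q''\in P_{\mathcal{L}''}$ there are $p',q'\in P_{\mathcal{L}'}$ with $p'$ occurring in $\hat\tau(p'')$ and $\hat\tau(q'')$ obtained from $\hat\tau(p'')$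 replacing $p'$ by $q'$. Its formula translation $\tau:F_{\mathcal{L}''}\to F_{\mathcal{L}'}$ is $\tau(c'')=\hat\tau(c'')$ for $c''\in C_{\mathcal{L}'',0}\cup P_{\mathcal{L}''}$ and $\tau(c''(\varphi_1,\dots,\varphi_n))=\hat\tau(c'')(\tau(\varphi_1),\dots,\tau(\varphi_n))$. A conservative translation is a triple $(\hat\tau,\vec\tau,\overleftarrow{\tau})$ with $\hat\tau$ a constructor translation, $\vec\tau:\mathcal{M}_{\mathcal{L}''}\to\mathcal{M}_{\mathcal{L}'}$, $\overleftarrow{\tau}:\mathcal{M}_{\mathcal{L}'}\to\mathcal{M}_{\mathcal{L}''}$, such that for all $M''\in\mathcal{M}_{\mathcal{L}''}$, $M'\in\mathcal{M}_{\mathcal{L}'}$, $\varphi''\in F_{\mathcal{L}''}$: $\vec\tau(M'')\Vdash_{\mathcal{L}'}\tau(\varphi'')$ implies $M''\Vdash_{\mathcal{L}''}\varphi''$, and $\overleftarrow{\tau}(M')\Vdash_{\mathcal{L}''}\varphi''$ implies $M'\Vdash_{\mathcal{L}'}\tau(\varphi'')$. $\tau$-identified symbols ($\hat\tau(c'')=c'^\bullet$) share the same name and are exactly the shared symbols. The coexistent combination $\mathcal{L}''\sqcup\mathcal{L}'$ has propositional symbols $P_{\mathcal{L}'}$, constructors $C_0=C_{\mathcal{L}'',0}\cup C_{\mathcal{L}',0}\cup(P_{\mathcal{L}''}\setminus P_{\mathcal{L}'})$, $C_n=C_{\mathcal{L}'',n}\cup C_{\mathcal{L}',n}$, models $\mathcal{M}_{\mathcal{L}'}$,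 and satisfaction $M'\Vdash_{\mathcal{L}''\sqcup\mathcal{L}'}\varphi$ iff $M'\Vdash_{\mathcal{L}'}\tau_\sqcup(\varphi)$, where $\tau_\sqcup:F_{\mathcal{L}''\sqcup\mathcal{L}'}\to F_{\mathcal{L}'}$ is: $\tau_\sqcup(c'')=\hat\tau(c'')$ for $c''\in C_{\mathcal{L}'',0}\cup P_{\mathcal{L}''}$; $\tau_\sqcup(c')=c'$ for $c'\in C_{\mathcal{L}',0}\cup P_{\mathcal{L}'}$; $\tau_\sqcup(c''(\varphi_1,\dots,\varphi_n))=\hat\tau(c'')(\tau_\sqcup(\varphi_1),\dots,\tau_\sqcup(\varphi_n))$ for $c''\in C_{\mathcal{L}'',n}$; $\tau_\sqcup(c'(\varphi_1,\dots,\varphi_n))=c'(\tau_\sqcup(\varphi_1),\dots,\tau_\sqcup(\varphi_n))$ for $c'\in C_{\mathcal{L}',n}$. -}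

module Defs where

open import Data.Nat using (ℕ; zero; suc)
open import Data.Fin using (Fin)
open import Data.Vec using (Vec; []; _∷_; lookup)
open import Data.Vec.Relation.Unary.Any using (Any)
open import Data.Vec.Relation.Binary.Pointwise.Inductive using (Pointwise)
open import Data.Sum using (_⊎_; inj₁; inj₂)
open import Data.Product using (Σ; ∃; ∃-syntax; _×_; _,_)
open import Relation.Nullary using (¬_)
open import Relation.Binary.PropositionalEquality using (_≡_)
open import Function.Bundles using (_↔_)

-- Terms over a signature C (C n = n-ary constructors) with leaves in V.

data Tm (C : ℕ → Set) (V : Set) : Set where
  var : V → Tm C V
  app : ∀ {n} → C n → Vec (Tm C V) n → Tm C V

mutual
  subst : ∀ {C V W} → (V → Tm C W) → Tm C V → Tm C W
  subst σ (var v)    = σ v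
  subst σ (app c ts) = app c (substs σ ts)

  substs : ∀ {C V W n} → (V → Tm C W) → Vec (Tm C V) n → Vec (Tm C W) n
  substs σ []       = []
  substs σ (t ∷ ts) = subst σ t ∷ substs σ ts

data Occurs {C : ℕ → Set} {V : Set} (x : V) : Tm C V → Set where
  here  : Occurs x (var x)
  there : ∀ {n} {c : C n} {ts} → Any (Occurs x) ts → Occurs x (app c ts)

data Replaced {C : ℕ → Set} {V : Set} (x y : V) : Tm C V → Tm C V → Set where
  rep-here  : Replaced x y (var x) (var y)
  rep-other : ∀ {v} → ¬ (v ≡ x) → Replaced x y (var v) (var v)
  rep-app   : ∀ {n} {c : C n} {ts us} →
              Pointwise (Replaced x y) ts us → Replaced x y (app c ts) (app c us)

record Logic : Set₁ where
  field
    C     : ℕ → Set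
    P     : Set
    P-den : P ↔ ℕ
    Mod   : Set
    _⊩_   : Mod → Tm C P → Set

  F : Set
  F = Tm C P

  -- n-argument maps of A_L: terms over propositional symbols and n argument places
  A : ℕ → Set
  A n = Tm C (P ⊎ Fin n)

  apply : ∀ {n} → A n → Vec F n → F
  apply a φs = subst σ a
    where
    σ : _ → F
    σ (inj₁ p) = var p
    σ (inj₂ i) = lookup φs i

  prop• : P → A 0
  prop• p = var (inj₁ p)

  const• : C 0 → A 0
  const• c = app c []

open Logic public using (F; A)

⊨ : (L : Logic) → F L → Set
⊨ L φ = ∀ (M : Logic.Mod L) → Logic._⊩_ L M φ

record ConstructorTranslation (L'' L' : Logic) : Set where
  module L'' = Logic L''
  module L'  = Logic L'
  field
    τc : ∀ n → L''.C n → A L' n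
    τp : L''.P → A L' 0
    -- injectivity on C_{L''} ∪ P_{L''}
    τc-inj  : ∀ n (c d : L''.C n) → τc n c ≡ τc n d → c ≡ d
    τp-inj  : ∀ (p q : L''.P) → τp p ≡ τp q → p ≡ q
    τcp-inj : ∀ (c : L''.C 0) (p : L''.P) → ¬ (τc 0 c ≡ τp p)
    τc0 : ∀ (c : L''.C 0) → ∃[ c' ] (τc 0 c ≡ L'.const• c')
    τp-ren : ∀ (p'' q'' : L''.P) → ∃[ p' ] ∃[ q' ]
               (Occurs (inj₁ p') (τp p'') × Replaced (inj₁ p') (inj₁ q') (τp p'') (τp q''))

  mutual
    τ : F L'' → F L'
    τ (var p)                = subst var' (τp p)
    τ (app {n = n} c φs)         = L'.apply (τc n c) (τs φs)

    τs : ∀ {n} → Vec (F L'') n → Vec (F L') n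
    τs []       = []
    τs (φ ∷ φs) = τ φ ∷ τs φs

    var' : L'.P ⊎ Fin 0 → F L'
    var' (inj₁ p) = var p
    var' (inj₂ ())

record ConservativeTranslation (L'' L' : Logic) : Set where
  field
    τ̂  : ConstructorTranslation L'' L'
  open ConstructorTranslation τ̂ public
  field
    τ→ : L''.Mod → L'.Mod
    τ← : L'.Mod → L''.Mod
    cons→ : ∀ (M'' : L''.Mod) (φ : F L'') → L'._⊩_ (τ→ M'') (τ φ) → L''._⊩_ M'' φ
    cons← : ∀ (M' : L'.Mod) (φ : F L'') → L''._⊩_ (τ← M') φ → L'._⊩_ M' (τ φ)

module _ {L'' L' : Logic} (T : ConservativeTranslation L'' L') where
  private
    module T = ConservativeTranslation T
    module L'' = Logic L''
    module L'  = Logic L'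

  Cc : ℕ → Set
  Cc zero    = (L''.C 0 ⊎ L'.C 0) ⊎ L''.P
  Cc (suc n) = L''.C (suc n) ⊎ L'.C (suc n)

  inj'' : ∀ n → L''.C n → Cc n
  inj'' zero    c = inj₁ (inj₁ c)
  inj'' (suc n) c = inj₁ c

  Fc : Set
  Fc = Tm Cc L'.P

  mutual
    τ⊔ : Fc → F L'
    τ⊔ (var p')                          = var p'
    τ⊔ (app {n = zero} (inj₁ (inj₁ c'')) []) = T.τ (app c'' [])
    τ⊔ (app {n = zero} (inj₁ (inj₂ c')) [])  = app c' []
    τ⊔ (app {n = zero} (inj₂ p'') [])        = T.τ (var p'')
    τ⊔ (app {n = suc n} (inj₁ c'') φs)       = L'.apply (T.τc (suc n) c'') (τ⊔s φs)
    τ⊔ (app {n = suc n} (inj₂ c') φs)        = app c' (τ⊔s φs)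

    τ⊔s : ∀ {n} → Vec Fc n → Vec (F L') n
    τ⊔s []       = []
    τ⊔s (φ ∷ φs) = τ⊔ φ ∷ τ⊔s φs

  Comb : Logic
  Comb = record
    { C     = Cc
    ; P     = L'.P
    ; P-den = L'.P-den
    ; Mod   = L'.Mod
    ; _⊩_   = λ M' φ → L'._⊩_ M' (τ⊔ φ)
    }

  mutual
    embed : F L'' → Fc
    embed (var p'')        = app {n = 0} (inj₂ p'') []
    embed (app {n = n} c φs)   = app (inj'' n c) (embeds φs)

    embeds : ∀ {n} → Vec (F L'') n → Vec Fc n
    embeds []       = []
    embeds (φ ∷ φs) = embed φ ∷ embeds φs

{-# OPTIONS --safe #-}
module Submission where

open import Defs
open import Data.Nat using (zero; suc)
open import Data.Vec using (Vec; []; _∷_)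
open import Relation.Binary.PropositionalEquality using (_≡_; refl; cong; cong₂)

module _ {L'' L' : Logic} (T : ConservativeTranslation L'' L') where
  private
    module T  = ConservativeTranslation T
    module L' = Logic L'

  mutual
    τ⊔-embed : (φ : F L'') → τ⊔ T (embed T φ) ≡ T.τ φ
    τ⊔-embed (var p)                = refl
    τ⊔-embed (app {n = zero} c [])  = refl
    τ⊔-embed (app {n = suc n} c φs) = cong (L'.apply (T.τc (suc n) c)) (τ⊔s-embeds φs)

    τ⊔s-embeds : ∀ {n} (φs : Vec (F L'') n) → τ⊔s T (embeds T φs) ≡ T.τs φs
    τ⊔s-embeds []       = refl
    τ⊔s-embeds (φ ∷ φs) = cong₂ _∷_ (τ⊔-embed φ) (τ⊔s-embeds φs)

  τ-preserves-validity : (φ : F L'') → ⊨ L'' φ → ⊨ L' (T.τ φ)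
  τ-preserves-validity φ ⊨φ M' = T.cons← M' φ (⊨φ (T.τ← M'))

  ⊨Comb-embed : (φ : F L'') → ⊨ L' (T.τ φ) → ⊨ (Comb T) (embed T φ)
  ⊨Comb-embed φ ⊨τφ M' rewrite τ⊔-embed φ = ⊨τφ M'

mainTheorem9 : (L'' L' : Logic) (T : ConservativeTranslation L'' L') (φ'' : F L'') →
    ⊨ L'' φ'' → ⊨ (Comb T) (embed T φ'')
mainTheorem9 L'' L' T φ'' ⊨φ'' = ⊨Comb-embed T φ'' (τ-preserves-validity T φ'' ⊨φ'')
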